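{- Let $p$ be an odd prime and let $\mathbf{A}_p=\left[\left(\frac{i+j-1}{p}\right)\right]_{1\le i,j\le p}$ be the $p\times p$ matrix of Legendre symbols. Then all cofactors of $\mathbf{A}_p$ are equal, i.e. the cofactor $c_{i,j}$ of entry $(i,j)$ is the same for all $1\le i,j\le p$.
   Context: For a prime $p$, the Legendre symbol $\left(\frac{a}{p}\right)$ is $0$ if $p\mid a$, $1$ if $a$ is a nonzero quadratic residue mod $p$, and $-1$ if $a$ is a quadratic nonresidue mod $p$. -}

module Defs where

open import Data.Nat using (ℕ; zero; suc; _+_; _*_; _%_)
open import Data.Nat.Properties using (_≟_)
open import Data.Nat.Divisibility using (_∣?_)
open import Data.Integer using (ℤ; +_; -_) renaming (_+_ to _+ℤ_; _*_ to _*ℤ_)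
open import Data.Fin using (Fin; zero; suc; toℕ; punchIn)
open import Data.Fin.Properties using (any?)
open import Relation.Nullary using (yes; no)

-- Legendre symbol (a / p), defined literally as in the context:
-- 0 if p ∣ a, 1 if a is a nonzero quadratic residue mod p (∃ x, x² ≡ a mod p),
-- -1 otherwise.  (The value for p = 0 is junk and never used.)
legendre : ℕ → ℕ → ℤ
legendre zero    a = + 0
legendre (suc q) a with suc q ∣? a
... | yes _ = + 0
... | no  _ with any? (λ (x : Fin (suc q)) → (toℕ x * toℕ x) % suc q ≟ a % suc q)
...   | yes _ = + 1
...   | no  _ = - (+ 1)

Matrix : ℕ → Set
Matrix n = Fin n → Fin n → ℤ

sumFin : ∀ {n} → (Fin n → ℤ) → ℤ
sumFin {zero}  f = + 0
sumFin {suc n} f = f zero +ℤ sumFin (λ k → f (suc k))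

sign : ℕ → ℤ
sign zero          = + 1
sign (suc zero)    = - (+ 1)
sign (suc (suc k)) = sign k

minor : ∀ {n} → Fin (suc n) → Fin (suc n) → Matrix (suc n) → Matrix n
minor i j M r c = M (punchIn i r) (punchIn j c)

det : ∀ {n} → Matrix n → ℤ
det {zero}  M = + 1
det {suc n} M = sumFin (λ j → sign (toℕ j) *ℤ (M zero j *ℤ det (minor zero j M)))

cofactor : ∀ {n} → Matrix (suc n) → Fin (suc n) → Fin (suc n) → ℤ
cofactor M i j = sign (toℕ i + toℕ j) *ℤ det (minor i j M)

-- A_p = [ ((i+j-1)/p) ]_{1≤i,j≤p}; with 0-based indices i',j' (i = i'+1, j = j'+1)
-- the entry is ((i'+j'+1)/p).
A : (p : ℕ) → Matrix p
A p i j = legendre p (toℕ i + toℕ j + 1)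

module Submission where

-- Linear algebra: if all rows of M sum
-- to zero, M is singular; the minors obtained by deleting column j or j+1
-- (and any row) differ in one column whose sum completes a matrix with zero
-- row sums, so their determinants are opposite and adjacent cofactors in a
-- row agree.  For symmetric M also c(i,j) = c(j,i), so all cofactors agree.  Number
-- theory: (a/p) + 1 counts the square roots of a mod p, so Σ_a (a/p) = 0;
-- by p-periodicity every row of A p sums to zero as well.

open import Defs
open import Data.Nat using (ℕ; suc)
open import Data.Nat.Primality using (Prime)
open import Data.Fin using (Fin)
open import Relation.Binary.PropositionalEquality using (_≡_; _≢_)

open import Algebra.Bundles using (AbelianGroup)
open import Data.Empty using (⊥-elim)
open import Data.Fin using (zero; suc; toℕ; fromℕ<; inject₁; punchIn; punchOut)
open import Data.Fin.Properties
  using (punchInᵢ≢i; punchIn-injective; punchIn-punchOut; toℕ-inject₁; toℕ-injective; toℕ<n; toℕ-fromℕ<; any?)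
  renaming (_≟_ to _≟ᶠ_)
open import Data.Integer using (ℤ; 0ℤ; 1ℤ; +_; -_; _+_; _*_)
open import Data.Integer.Properties using (+-0-abelianGroup; +-identityʳ; neg-involutive)
open import Data.Integer.Tactic.RingSolver using (solve-∀)
open import Data.Nat using (zero; _≤_; _<_; _∸_; _%_; _/_) renaming (_+_ to _+ℕ_; _*_ to _*ℕ_)
import Data.Nat.Properties as ℕ
open import Data.Nat.Properties using (_≟_)
open import Data.Nat.DivMod using (m≡m%n+[m/n]*n; m<n⇒m%n≡m; m%n<n; [m+kn]%n≡m%n; [m+n]%n≡m%n)
open import Data.Nat.Divisibility using (_∣_; divides; _∣?_; m%n≡0⇒n∣m; n∣m⇒m%n≡0; >⇒∤)
open import Data.Nat.Primality using (euclidsLemma; prime⇒irreducible; ¬prime[1])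
open import Data.Nat.Tactic.RingSolver using () renaming (solve-∀ to solveℕ)
open import Data.Product using (Σ; _,_; _×_)
open import Data.Sum using (_⊎_; inj₁; inj₂; [_,_]′)
open import Function using (_∘_)
open import Relation.Nullary using (Dec; yes; no; ¬_)
open import Relation.Binary.PropositionalEquality using (refl; sym; trans; cong; cong₂; subst; module ≡-Reasoning)
open import Algebra.Properties.Group (AbelianGroup.group +-0-abelianGroup)
  using (inverseʳ-unique; identityˡ-unique; ∙-cancelʳ)

open ≡-Reasoning

sumFin-cong : ∀ {n} {f g : Fin n → ℤ} → (∀ k → f k ≡ g k) → sumFin f ≡ sumFin g
sumFin-cong {zero}  e = refl
sumFin-cong {suc n} e = cong₂ _+_ (e zero) (sumFin-cong (e ∘ suc))

sumFin-zero : ∀ {n} (f : Fin n → ℤ) → (∀ k → f k ≡ 0ℤ) → sumFin f ≡ 0ℤ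
sumFin-zero {zero}  f e = refl
sumFin-zero {suc n} f e = cong₂ _+_ (e zero) (sumFin-zero (f ∘ suc) (e ∘ suc))

sumFin-one : ∀ n → sumFin {n} (λ _ → 1ℤ) ≡ + n
sumFin-one zero    = refl
sumFin-one (suc n) = cong (_+_ 1ℤ) (sumFin-one n)

sumFin-+ : ∀ {n} (f g : Fin n → ℤ) → sumFin (λ k → f k + g k) ≡ sumFin f + sumFin g
sumFin-+ {zero}  f g = refl
sumFin-+ {suc n} f g =
  trans (cong (_+_ (f zero + g zero)) (sumFin-+ (f ∘ suc) (g ∘ suc)))
        (interchange (f zero) (g zero) (sumFin (f ∘ suc)) (sumFin (g ∘ suc)))
  where
  interchange : ∀ a b c d → (a + b) + (c + d) ≡ (a + c) + (b + d)
  interchange = solve-∀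

sumFin-*ˡ : ∀ {n} (x : ℤ) (f : Fin n → ℤ) → x * sumFin f ≡ sumFin (λ k → x * f k)
sumFin-*ˡ {zero}  x f = annihilate x
  where
  annihilate : ∀ x → x * 0ℤ ≡ 0ℤ
  annihilate = solve-∀
sumFin-*ˡ {suc n} x f =
  trans (distrib x (f zero) (sumFin (f ∘ suc))) (cong (_+_ (x * f zero)) (sumFin-*ˡ x (f ∘ suc)))
  where
  distrib : ∀ x a b → x * (a + b) ≡ x * a + x * b
  distrib = solve-∀

sumFin-swap : ∀ {m n} (F : Fin m → Fin n → ℤ) →
  sumFin (λ i → sumFin (F i)) ≡ sumFin (λ j → sumFin (λ i → F i j))
sumFin-swap {zero}  {n} F = sym (sumFin-zero {n} (λ _ → 0ℤ) (λ _ → refl))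
sumFin-swap {suc m} {n} F =
  trans (cong (_+_ (sumFin (F zero))) (sumFin-swap (F ∘ suc)))
        (sym (sumFin-+ (F zero) (λ j → sumFin (λ i → F (suc i) j))))

sumFin-punchIn : ∀ {n} (f : Fin (suc n) → ℤ) (u : Fin (suc n)) →
  sumFin f ≡ f u + sumFin (f ∘ punchIn u)
sumFin-punchIn f       zero    = refl
sumFin-punchIn {suc n} f (suc u) =
  trans (cong (_+_ (f zero)) (sumFin-punchIn (f ∘ suc) u)) (left-comm (f zero) (f (suc u)) _)
  where
  left-comm : ∀ a b c → a + (b + c) ≡ b + (a + c)
  left-comm = solve-∀

sumFin-single : ∀ {n} (f : Fin (suc n) → ℤ) (u : Fin (suc n)) →
  (∀ x → x ≢ u → f x ≡ 0ℤ) → sumFin f ≡ f u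
sumFin-single f u vanish = begin
  sumFin f                     ≡⟨ sumFin-punchIn f u ⟩
  f u + sumFin (f ∘ punchIn u) ≡⟨ cong (_+_ (f u)) (sumFin-zero _ (λ k → vanish _ (punchInᵢ≢i u k))) ⟩
  f u + 0ℤ                     ≡⟨ +-identityʳ (f u) ⟩
  f u                          ∎

sumFin-pair : ∀ {n} (f : Fin (suc n) → ℤ) (u v : Fin (suc n)) → u ≢ v →
  (∀ x → x ≢ u → x ≢ v → f x ≡ 0ℤ) → sumFin f ≡ f u + f v
sumFin-pair {zero}  f zero zero u≢v vanish = ⊥-elim (u≢v refl)
sumFin-pair {suc n} f u    v    u≢v vanish = begin
  sumFin f                     ≡⟨ sumFin-punchIn f u ⟩
  f u + sumFin (f ∘ punchIn u) ≡⟨ cong (_+_ (f u)) (sumFin-single (f ∘ punchIn u) v′ vanish′) ⟩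
  f u + f (punchIn u v′)       ≡⟨ cong (λ w → f u + f w) (punchIn-punchOut u≢v) ⟩
  f u + f v                    ∎
  where
  v′ = punchOut u≢v
  vanish′ : ∀ k → k ≢ v′ → f (punchIn u k) ≡ 0ℤ
  vanish′ k k≢v′ = vanish _ (punchInᵢ≢i u k)
    (λ e → k≢v′ (punchIn-injective u k v′ (trans e (sym (punchIn-punchOut u≢v)))))

sumFin-bump : ∀ {n} (f g : Fin (suc n) → ℤ) (j : Fin (suc n)) (x : ℤ) →
  (∀ c → c ≢ j → g c ≡ f c) → g j ≡ f j + x → sumFin g ≡ x + sumFin f
sumFin-bump f g j x same bumped = begin
  sumFin g                           ≡⟨ sumFin-punchIn g j ⟩
  g j + sumFin (g ∘ punchIn j)       ≡⟨ cong₂ _+_ bumped (sumFin-cong (λ k → same _ (punchInᵢ≢i j k))) ⟩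
  (f j + x) + sumFin (f ∘ punchIn j) ≡⟨ rearrange (f j) x _ ⟩
  x + (f j + sumFin (f ∘ punchIn j)) ≡⟨ cong (_+_ x) (sym (sumFin-punchIn f j)) ⟩
  x + sumFin f                       ∎
  where
  rearrange : ∀ a x b → (a + x) + b ≡ x + (a + b)
  rearrange = solve-∀

sign-suc : ∀ k → sign (suc k) ≡ - sign k
sign-suc zero          = refl
sign-suc (suc zero)    = refl
sign-suc (suc (suc k)) = sign-suc k

_≋_ : ∀ {n} → Matrix n → Matrix n → Set
M ≋ N = ∀ r c → M r c ≡ N r c

det-cong : ∀ {n} {M N : Matrix n} → M ≋ N → det M ≡ det N
det-cong {zero}          e = refl
det-cong {suc n} {M} {N} e = sumFin-cong λ j →
  cong₂ (λ a d → sign (toℕ j) * (a * d)) (e zero j)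
        (det-cong {M = minor zero j M} {N = minor zero j N} (λ r c → e (suc r) (punchIn j c)))

laplaceTerm : ∀ {n} → Matrix (suc n) → Fin (suc n) → ℤ
laplaceTerm M j = sign (toℕ j) * (M zero j * det (minor zero j M))

-- By
-- induction: the k-th Laplace term splits directly, the others by the
-- induction hypothesis applied to the minors.
det-additive : ∀ {n} (k : Fin n) (M N P : Matrix n) →
  (∀ r c → c ≢ k → M r c ≡ P r c) → (∀ r c → c ≢ k → N r c ≡ P r c) →
  (∀ r → P r k ≡ M r k + N r k) → det P ≡ det M + det N
det-additive {suc n} k M N P M≈P N≈P Pk =
  trans (sumFin-cong termwise) (sumFin-+ (laplaceTerm M) (laplaceTerm N))
  where
  distribˡ : ∀ s a b d → s * ((a + b) * d) ≡ s * (a * d) + s * (b * d)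
  distribˡ = solve-∀
  distribʳ : ∀ s a d e → s * (a * (d + e)) ≡ s * (a * d) + s * (a * e)
  distribʳ = solve-∀
  termwise : ∀ j → laplaceTerm P j ≡ laplaceTerm M j + laplaceTerm N j
  termwise j with j ≟ᶠ k
  ... | yes refl = begin
      s * (P zero j * det (minor zero j P))
        ≡⟨ cong₂ (λ a d → s * (a * d)) (Pk zero)
                 (det-cong (λ r c → sym (M≈P (suc r) (punchIn j c) (punchInᵢ≢i j c)))) ⟩
      s * ((M zero j + N zero j) * det (minor zero j M))
        ≡⟨ distribˡ s (M zero j) (N zero j) _ ⟩
      s * (M zero j * det (minor zero j M)) + s * (N zero j * det (minor zero j M))
        ≡⟨ cong (λ d → laplaceTerm M j + s * (N zero j * d)) (det-cong minorM≋minorN) ⟩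
      laplaceTerm M j + laplaceTerm N j ∎
    where
    s = sign (toℕ j)
    minorM≋minorN : minor zero j M ≋ minor zero j N
    minorM≋minorN r c = trans (M≈P (suc r) (punchIn j c) (punchInᵢ≢i j c))
                              (sym (N≈P (suc r) (punchIn j c) (punchInᵢ≢i j c)))
  ... | no j≢k = begin
      s * (P zero j * det (minor zero j P))
        ≡⟨ cong (λ d → s * (P zero j * d)) minors-additive ⟩
      s * (P zero j * (det (minor zero j M) + det (minor zero j N)))
        ≡⟨ distribʳ s (P zero j) _ _ ⟩
      s * (P zero j * det (minor zero j M)) + s * (P zero j * det (minor zero j N))
        ≡⟨ cong₂ (λ a b → s * (a * det (minor zero j M)) + s * (b * det (minor zero j N)))
                 (sym (M≈P zero j j≢k)) (sym (N≈P zero j j≢k)) ⟩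
      laplaceTerm M j + laplaceTerm N j ∎
    where
    s = sign (toℕ j)
    k′ = punchOut j≢k
    k′↦k : punchIn j k′ ≡ k
    k′↦k = punchIn-punchOut j≢k
    avoids : ∀ c → c ≢ k′ → punchIn j c ≢ k
    avoids c c≢k′ e = c≢k′ (punchIn-injective j c k′ (trans e (sym k′↦k)))
    minors-additive : det (minor zero j P) ≡ det (minor zero j M) + det (minor zero j N)
    minors-additive = det-additive k′ (minor zero j M) (minor zero j N) (minor zero j P)
      (λ r c c≢k′ → M≈P (suc r) (punchIn j c) (avoids c c≢k′))
      (λ r c c≢k′ → N≈P (suc r) (punchIn j c) (avoids c c≢k′))
      (λ r → subst (λ z → P (suc r) z ≡ M (suc r) z + N (suc r) z) (sym k′↦k) (Pk (suc r)))

-- A matrix with a zero column has determinant zero (det M = det M + det M).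
det-zeroColumn : ∀ {n} (k : Fin n) (M : Matrix n) → (∀ r → M r k ≡ 0ℤ) → det M ≡ 0ℤ
det-zeroColumn k M zeroCol = identityˡ-unique (det M) (det M)
  (sym (det-additive k M M M (λ _ _ _ → refl) (λ _ _ _ → refl)
         (λ r → trans (zeroCol r) (sym (cong₂ _+_ (zeroCol r) (zeroCol r))))))

setCol : ∀ {n} → Matrix n → Fin n → (Fin n → ℤ) → Matrix n
setCol M k v r c with c ≟ᶠ k
... | yes _ = v r
... | no _  = M r c

setCol-same : ∀ {n} (M : Matrix n) k v r → setCol M k v r k ≡ v r
setCol-same M k v r with k ≟ᶠ k
... | yes _   = refl
... | no k≢k = ⊥-elim (k≢k refl)

setCol-other : ∀ {n} (M : Matrix n) k v r c → c ≢ k → setCol M k v r c ≡ M r c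
setCol-other M k v r c c≢k with c ≟ᶠ k
... | yes c≡k = ⊥-elim (c≢k c≡k)
... | no _    = refl

setCol-self : ∀ {n} (M : Matrix n) k → setCol M k (λ r → M r k) ≋ M
setCol-self M k r c with c ≟ᶠ k
... | yes refl = refl
... | no _     = refl

setCol-comm : ∀ {n} (M : Matrix n) a b u w → a ≢ b →
  setCol (setCol M a u) b w ≋ setCol (setCol M b w) a u
setCol-comm M a b u w a≢b r c = by-cases (c ≟ᶠ a) (c ≟ᶠ b)
  where
  by-cases : Dec (c ≡ a) → Dec (c ≡ b) → setCol (setCol M a u) b w r c ≡ setCol (setCol M b w) a u r c
  by-cases (yes refl) (yes refl) = ⊥-elim (a≢b refl)
  by-cases (yes refl) (no c≢b)   =
    trans (setCol-other _ b w r c c≢b) (trans (setCol-same M c u r) (sym (setCol-same _ c u r)))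
  by-cases (no c≢a)   (yes refl) =
    trans (setCol-same _ c w r) (trans (sym (setCol-same M c w r)) (sym (setCol-other _ a u r c c≢a)))
  by-cases (no c≢a)   (no c≢b)   =
    trans (setCol-other _ b w r c c≢b) (trans (setCol-other M a u r c c≢a)
      (sym (trans (setCol-other _ a u r c c≢a) (setCol-other M b w r c c≢b))))

det-setCol-+ : ∀ {n} (M : Matrix n) k (u w : Fin n → ℤ) →
  det (setCol M k (λ r → u r + w r)) ≡ det (setCol M k u) + det (setCol M k w)
det-setCol-+ M k u w = det-additive k (setCol M k u) (setCol M k w) (setCol M k (λ r → u r + w r))
  (λ r c c≢k → trans (setCol-other M k u r c c≢k) (sym (setCol-other M k _ r c c≢k)))
  (λ r c c≢k → trans (setCol-other M k w r c c≢k) (sym (setCol-other M k _ r c c≢k)))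
  (λ r → trans (setCol-same M k _ r) (sym (cong₂ _+_ (setCol-same M k u r) (setCol-same M k w r))))

det-setCol-sum : ∀ {n m} (M : Matrix n) k (F : Fin m → Fin n → ℤ) →
  det (setCol M k (λ r → sumFin (λ t → F t r))) ≡ sumFin (λ t → det (setCol M k (F t)))
det-setCol-sum {m = zero}  M k F = det-zeroColumn k (setCol M k (λ _ → 0ℤ)) (setCol-same M k _)
det-setCol-sum {m = suc m} M k F =
  trans (det-setCol-+ M k (F zero) (λ r → sumFin (λ t → F (suc t) r)))
        (cong (_+_ (det (setCol M k (F zero)))) (det-setCol-sum M k (F ∘ suc)))

-- Column bookkeeping for two adjacent columns j and j+1: deleting either of
-- them leaves the same columns in the same places, except at position j,
-- where each deletion keeps the other one.
punchIn-inject₁-self : ∀ {n} (j : Fin n) → punchIn (inject₁ j) j ≡ suc j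
punchIn-inject₁-self zero    = refl
punchIn-inject₁-self (suc j) = cong suc (punchIn-inject₁-self j)

punchIn-suc-self : ∀ {n} (j : Fin n) → punchIn (suc j) j ≡ inject₁ j
punchIn-suc-self zero    = refl
punchIn-suc-self (suc j) = cong suc (punchIn-suc-self j)

punchIn-adjacent : ∀ {n} (j c : Fin n) → c ≢ j → punchIn (inject₁ j) c ≡ punchIn (suc j) c
punchIn-adjacent zero    zero    c≢j = ⊥-elim (c≢j refl)
punchIn-adjacent zero    (suc c) c≢j = refl
punchIn-adjacent (suc j) zero    c≢j = refl
punchIn-adjacent (suc j) (suc c) c≢j = cong suc (punchIn-adjacent j c (c≢j ∘ cong suc))

inject₁≢suc : ∀ {n} (x : Fin n) → inject₁ x ≢ suc x
inject₁≢suc x e = ℕ.m≢1+n+m (toℕ x) {0} (trans (sym (toℕ-inject₁ x)) (cong toℕ e))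

minor-adjacentEqual : ∀ {n} (M : Matrix (suc (suc n))) (x : Fin (suc n)) →
  (∀ r → M r (inject₁ x) ≡ M r (suc x)) → ∀ i → minor i (inject₁ x) M ≋ minor i (suc x) M
minor-adjacentEqual M x equal i r c with c ≟ᶠ x
... | yes refl = trans (cong (M (punchIn i r)) (punchIn-inject₁-self c))
                   (trans (sym (equal _)) (cong (M (punchIn i r)) (sym (punchIn-suc-self c))))
... | no c≢x   = cong (M (punchIn i r)) (punchIn-adjacent x c c≢x)

punchIn-adjacentPair : ∀ {n} (j : Fin (suc (suc n))) (x : Fin (suc n)) → j ≢ inject₁ x → j ≢ suc x →
  Σ (Fin n) λ x′ → punchIn j (inject₁ x′) ≡ inject₁ x × punchIn j (suc x′) ≡ suc x
punchIn-adjacentPair zero             zero    j≢x j≢x+1 = ⊥-elim (j≢x refl)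
punchIn-adjacentPair zero             (suc x) j≢x j≢x+1 = x , refl , refl
punchIn-adjacentPair (suc zero)       zero    j≢x j≢x+1 = ⊥-elim (j≢x+1 refl)
punchIn-adjacentPair {suc n} (suc (suc j)) zero j≢x j≢x+1 = zero , refl , refl
punchIn-adjacentPair {suc n} (suc j)  (suc x) j≢x j≢x+1
  with punchIn-adjacentPair j x (j≢x ∘ cong suc) (j≢x+1 ∘ cong suc)
... | x′ , e₁ , e₂ = suc x′ , cong suc e₁ , cong suc e₂

-- In the first-row
-- expansion the minors of all other columns again have two equal adjacent
-- columns, and the two remaining terms cancel because their minors coincide
-- while their signs are opposite.
det-adjacentEqual : ∀ {n} (x : Fin n) (M : Matrix (suc n)) →
  (∀ r → M r (inject₁ x) ≡ M r (suc x)) → det M ≡ 0ℤ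
det-adjacentEqual {suc n} x M equal = begin
  det M
    ≡⟨ sumFin-pair (laplaceTerm M) (inject₁ x) (suc x) (inject₁≢suc x) others-vanish ⟩
  laplaceTerm M (inject₁ x) + laplaceTerm M (suc x)
    ≡⟨ cong₂ _+_ (cong₂ (λ t e → sign t * e) (toℕ-inject₁ x)
                        (cong₂ _*_ (equal zero) (det-cong (minor-adjacentEqual M x equal zero))))
                 (cong (λ t → t * (m * d)) (sign-suc (toℕ x))) ⟩
  s * (m * d) + (- s) * (m * d)
    ≡⟨ cancel s m d ⟩
  0ℤ ∎
  where
  s = sign (toℕ x)
  m = M zero (suc x)
  d = det (minor zero (suc x) M)
  cancel : ∀ s m d → s * (m * d) + (- s) * (m * d) ≡ 0ℤ
  cancel = solve-∀
  annihilate : ∀ s a → s * (a * 0ℤ) ≡ 0ℤ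
  annihilate = solve-∀
  others-vanish : ∀ j → j ≢ inject₁ x → j ≢ suc x → laplaceTerm M j ≡ 0ℤ
  others-vanish j j≢x j≢x+1 with punchIn-adjacentPair j x j≢x j≢x+1
  ... | x′ , e₁ , e₂ =
    trans (cong (λ d → sign (toℕ j) * (M zero j * d))
                (det-adjacentEqual x′ (minor zero j M)
                  (λ r → trans (cong (M (suc r)) e₁) (trans (equal (suc r)) (sym (cong (M (suc r)) e₂))))))
          (annihilate (sign (toℕ j)) (M zero j))

swapCols : ∀ {n} → Matrix n → Fin n → Fin n → Matrix n
swapCols M a b = setCol (setCol M a (λ r → M r b)) b (λ r → M r a)

-- Write D u w for
-- the determinant of M with columns x, x+1 replaced by u, w.  D is additive in
-- each slot and D v v = 0, so 0 = D (u+w) (u+w) = D u w + D w u.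
det-swapAdjacent : ∀ {n} (x : Fin n) (M : Matrix (suc n)) →
  det (swapCols M (inject₁ x) (suc x)) ≡ - det M
det-swapAdjacent x M = inverseʳ-unique (det M) (det (swapCols M a b)) (begin
  det M + D cb ca               ≡⟨ cong (λ e → e + D cb ca) (sym D-original) ⟩
  D ca cb + D cb ca             ≡⟨ sym (units (D ca cb) (D cb ca)) ⟩
  (0ℤ + D ca cb) + (D cb ca + 0ℤ)
    ≡⟨ cong₂ (λ e f → (e + D ca cb) + (D cb ca + f)) (sym (D-diagonal ca)) (sym (D-diagonal cb)) ⟩
  (D ca ca + D ca cb) + (D cb ca + D cb cb)
    ≡⟨ cong₂ _+_ (sym (D-additiveʳ ca ca cb)) (sym (D-additiveʳ cb ca cb)) ⟩
  D ca (λ r → ca r + cb r) + D cb (λ r → ca r + cb r)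
    ≡⟨ sym (D-additiveˡ ca cb (λ r → ca r + cb r)) ⟩
  D (λ r → ca r + cb r) (λ r → ca r + cb r)
    ≡⟨ D-diagonal (λ r → ca r + cb r) ⟩
  0ℤ ∎)
  where
  a = inject₁ x
  b = suc x
  a≢b = inject₁≢suc x
  ca cb : Fin _ → ℤ
  ca r = M r a
  cb r = M r b
  D : (Fin _ → ℤ) → (Fin _ → ℤ) → ℤ
  D u w = det (setCol (setCol M a u) b w)
  D-additiveʳ : ∀ v u w → D v (λ r → u r + w r) ≡ D v u + D v w
  D-additiveʳ v = det-setCol-+ (setCol M a v) b
  D-additiveˡ : ∀ u w v → D (λ r → u r + w r) v ≡ D u v + D w v
  D-additiveˡ u w v =
    trans (det-cong (setCol-comm M a b _ v a≢b))
      (trans (det-setCol-+ (setCol M b v) a u w)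
        (sym (cong₂ _+_ (det-cong (setCol-comm M a b u v a≢b)) (det-cong (setCol-comm M a b w v a≢b)))))
  D-diagonal : ∀ v → D v v ≡ 0ℤ
  D-diagonal v = det-adjacentEqual x (setCol (setCol M a v) b v)
    (λ r → trans (setCol-other _ b v r a a≢b) (trans (setCol-same M a v r) (sym (setCol-same _ b v r))))
  D-original : D ca cb ≡ det M
  D-original = det-cong restored
    where
    restored : setCol (setCol M a ca) b cb ≋ M
    restored r c = by-cases (c ≟ᶠ b)
      where
      by-cases : Dec (c ≡ b) → setCol (setCol M a ca) b cb r c ≡ M r c
      by-cases (yes refl) = setCol-same _ c cb r
      by-cases (no c≢b)   = trans (setCol-other _ b cb r c c≢b) (setCol-self M a r c)
  units : ∀ q r → (0ℤ + q) + (r + 0ℤ) ≡ q + r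
  units = solve-∀

-- Two equal columns a < b, at distance d+1, force determinant zero: exchanging
-- columns b-1 and b only changes the sign and brings the copy one step closer.
det-equalColumns : ∀ {n} d (a b : Fin (suc n)) (M : Matrix (suc n)) →
  toℕ b ≡ toℕ a +ℕ suc d → (∀ r → M r a ≡ M r b) → det M ≡ 0ℤ
det-equalColumns d a zero M b≡a+d+1 equal = ⊥-elim (ℕ.0≢1+n (trans b≡a+d+1 (ℕ.+-suc (toℕ a) d)))
det-equalColumns {suc n} zero a (suc x) M b≡a+1 equal =
  det-adjacentEqual x M (λ r → subst (λ z → M r z ≡ M r (suc x)) a≡x (equal r))
  where
  a≡x : a ≡ inject₁ x
  a≡x = toℕ-injective (trans (sym (ℕ.suc-injective (trans b≡a+1 (ℕ.+-comm (toℕ a) 1))))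
                             (sym (toℕ-inject₁ x)))
det-equalColumns {suc n} (suc d) a (suc x) M b≡a+d+2 equal = begin
  det M     ≡⟨ sym (neg-involutive (det M)) ⟩
  - - det M ≡⟨ cong -_ (sym (det-swapAdjacent x M)) ⟩
  - det P   ≡⟨ cong -_ (det-equalColumns d a (inject₁ x) P x≡a+d+1 P-equal) ⟩
  0ℤ        ∎
  where
  P = swapCols M (inject₁ x) (suc x)
  x≡a+d+1 : toℕ (inject₁ x) ≡ toℕ a +ℕ suc d
  x≡a+d+1 = trans (toℕ-inject₁ x) (ℕ.suc-injective (trans b≡a+d+2 (ℕ.+-suc (toℕ a) (suc d))))
  a≢x : a ≢ inject₁ x
  a≢x e = ℕ.m≢1+m+n (toℕ a) (trans (cong toℕ e) (trans x≡a+d+1 (ℕ.+-suc (toℕ a) d)))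
  a≢x+1 : a ≢ suc x
  a≢x+1 e = ℕ.m≢1+m+n (toℕ a) (trans (cong toℕ e) (trans b≡a+d+2 (ℕ.+-suc (toℕ a) (suc d))))
  P-equal : ∀ r → P r a ≡ P r (inject₁ x)
  P-equal r = begin
    P r a                        ≡⟨ setCol-other _ (suc x) _ r a a≢x+1 ⟩
    setCol M (inject₁ x) _ r a   ≡⟨ setCol-other M (inject₁ x) _ r a a≢x ⟩
    M r a                        ≡⟨ equal r ⟩
    M r (suc x)                  ≡⟨ sym (setCol-same M (inject₁ x) _ r) ⟩
    setCol M (inject₁ x) _ r (inject₁ x)
      ≡⟨ sym (setCol-other _ (suc x) _ r (inject₁ x) (inject₁≢suc x)) ⟩
    P r (inject₁ x)              ∎

-- A matrix whose rows all sum to zero is singular: replacing column 0 by the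
-- sum of all columns yields a zero column, while by additivity it yields
-- det M plus determinants of matrices with two equal columns.
det-rowSumsZero : ∀ {n} (M : Matrix (suc n)) → (∀ r → sumFin (M r) ≡ 0ℤ) → det M ≡ 0ℤ
det-rowSumsZero M rowSum = begin
  det M
    ≡⟨ sym (+-identityʳ (det M)) ⟩
  det M + 0ℤ
    ≡⟨ cong₂ _+_ (sym (det-cong (setCol-self M zero))) (sym (sumFin-zero _ repeated)) ⟩
  sumFin (λ t → det (setCol M zero (λ r → M r t)))
    ≡⟨ sym (det-setCol-sum M zero (λ t r → M r t)) ⟩
  det (setCol M zero (λ r → sumFin (M r)))
    ≡⟨ det-zeroColumn zero (setCol M zero (λ r → sumFin (M r)))
                      (λ r → trans (setCol-same M zero (λ r → sumFin (M r)) r) (rowSum r)) ⟩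
  0ℤ ∎
  where
  repeated : ∀ t → det (setCol M zero (λ r → M r (suc t))) ≡ 0ℤ
  repeated t = det-equalColumns (toℕ t) zero (suc t) (setCol M zero column) refl
    (λ r → trans (setCol-same M zero column r) (sym (setCol-other M zero column r (suc t) λ ())))
    where
    column = λ r → M r (suc t)

-- By induction, expanding every first-row
-- minor along its first column turns both expansions into the same double sum
-- over the entries (0, c+1) and (r+1, 0), summed in opposite orders.
det-firstColumn : ∀ {n} (M : Matrix (suc n)) →
  det M ≡ sumFin (λ i → sign (toℕ i) * (M i zero * det (minor i zero M)))
det-firstColumn {zero}  M = refl
det-firstColumn {suc n} M =
  cong (_+_ (laplaceTerm M zero)) (trans rowSide (trans (sumFin-swap T) (sym columnSide)))
  where
  a b : Fin (suc n) → ℤ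
  a c = M zero (suc c)
  b r = M (suc r) zero
  -- The complementary minor of the entries (0, c+1) and (r+1, 0).
  D : Fin (suc n) → Fin (suc n) → ℤ
  D c r = det (minor r zero (minor zero (suc c) M))
  T : Fin (suc n) → Fin (suc n) → ℤ
  T c r = - (sign (toℕ c) * sign (toℕ r) * (a c * b r * D c r))
  expand : ∀ s x {m} (f : Fin m → ℤ) → s * (x * sumFin f) ≡ sumFin (λ k → s * (x * f k))
  expand s x f = trans (cong (_*_ s) (sumFin-*ˡ x f)) (sumFin-*ˡ s (λ k → x * f k))
  rowTerm : ∀ s t x y d → (- s) * (x * (t * (y * d))) ≡ - (s * t * (x * y * d))
  rowTerm = solve-∀
  columnTerm : ∀ s t x y d → (- t) * (y * (s * (x * d))) ≡ - (s * t * (x * y * d))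
  columnTerm = solve-∀
  rowSide : sumFin (λ c → sign (toℕ (suc c)) * (a c * det (minor zero (suc c) M)))
          ≡ sumFin (λ c → sumFin (T c))
  rowSide = sumFin-cong λ c → begin
    sign (toℕ (suc c)) * (a c * det (minor zero (suc c) M))
      ≡⟨ cong (λ d → sign (toℕ (suc c)) * (a c * d)) (det-firstColumn (minor zero (suc c) M)) ⟩
    sign (toℕ (suc c)) * (a c * sumFin (λ r → sign (toℕ r) * (b r * D c r)))
      ≡⟨ expand (sign (toℕ (suc c))) (a c) (λ r → sign (toℕ r) * (b r * D c r)) ⟩
    sumFin (λ r → sign (toℕ (suc c)) * (a c * (sign (toℕ r) * (b r * D c r))))
      ≡⟨ sumFin-cong (λ r → trans (cong (λ s → s * (a c * (sign (toℕ r) * (b r * D c r)))) (sign-suc (toℕ c)))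
                                  (rowTerm (sign (toℕ c)) (sign (toℕ r)) (a c) (b r) (D c r))) ⟩
    sumFin (T c) ∎
  columnSide : sumFin (λ r → sign (toℕ (suc r)) * (b r * det (minor (suc r) zero M)))
             ≡ sumFin (λ r → sumFin (λ c → T c r))
  columnSide = sumFin-cong λ r → begin
    sign (toℕ (suc r)) * (b r * sumFin (λ c → sign (toℕ c) * (a c * D c r)))
      ≡⟨ expand (sign (toℕ (suc r))) (b r) (λ c → sign (toℕ c) * (a c * D c r)) ⟩
    sumFin (λ c → sign (toℕ (suc r)) * (b r * (sign (toℕ c) * (a c * D c r))))
      ≡⟨ sumFin-cong (λ c → trans (cong (λ t → t * (b r * (sign (toℕ c) * (a c * D c r)))) (sign-suc (toℕ r)))
                                  (columnTerm (sign (toℕ c)) (sign (toℕ r)) (a c) (b r) (D c r))) ⟩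
    sumFin (λ c → T c r) ∎

transpose : ∀ {n} → Matrix n → Matrix n
transpose M r c = M c r

-- Transposition preserves the determinant: the first-row expansion of the
-- transpose is the first-column expansion of M.
det-transpose : ∀ {n} (M : Matrix n) → det (transpose M) ≡ det M
det-transpose {zero}  M = refl
det-transpose {suc n} M =
  trans (sumFin-cong (λ j → cong (λ d → sign (toℕ j) * (M j zero * d)) (det-transpose (minor j zero M))))
        (sym (det-firstColumn M))

-- The two minors differ
-- only in column j, and adding that column of the second to the first gives
-- a matrix whose row sums are row sums of M, hence zero.
minors-adjacent-opposite : ∀ {n} (M : Matrix (suc (suc n))) → (∀ r → sumFin (M r) ≡ 0ℤ) →
  (i : Fin (suc (suc n))) (j : Fin (suc n)) →
  det (minor i (inject₁ j) M) + det (minor i (suc j) M) ≡ 0ℤ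
minors-adjacent-opposite M rowSum i j = begin
  det N + det N′
    ≡⟨ cong₂ _+_ (sym (det-cong (setCol-self N j))) (sym (det-cong N′-from-N)) ⟩
  det (setCol N j colN) + det (setCol N j colN′)
    ≡⟨ sym (det-setCol-+ N j colN colN′) ⟩
  det Q
    ≡⟨ det-rowSumsZero Q Q-rowSum ⟩
  0ℤ ∎
  where
  row : Fin _ → Fin _ → ℤ
  row r = M (punchIn i r)
  N N′ Q : Matrix _
  N  = minor i (inject₁ j) M
  N′ = minor i (suc j) M
  colN colN′ : Fin _ → ℤ
  colN  r = N r j
  colN′ r = N′ r j
  Q = setCol N j (λ r → colN r + colN′ r)
  N′-from-N : setCol N j colN′ ≋ N′
  N′-from-N r c = by-cases (c ≟ᶠ j)
    where
    by-cases : Dec (c ≡ j) → setCol N j colN′ r c ≡ N′ r c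
    by-cases (yes refl) = setCol-same N c colN′ r
    by-cases (no c≢j)   = trans (setCol-other N j colN′ r c c≢j) (cong (row r) (punchIn-adjacent j c c≢j))
  Q-rowSum : ∀ r → sumFin (Q r) ≡ 0ℤ
  Q-rowSum r = begin
    sumFin (Q r)
      ≡⟨ sumFin-bump (N r) (Q r) j (colN′ r) (λ c c≢j → setCol-other N j _ r c c≢j) (setCol-same N j _ r) ⟩
    colN′ r + sumFin (N r)
      ≡⟨ cong (λ c → row r c + sumFin (N r)) (punchIn-suc-self j) ⟩
    row r (inject₁ j) + sumFin (row r ∘ punchIn (inject₁ j))
      ≡⟨ sym (sumFin-punchIn (row r) (inject₁ j)) ⟩
    sumFin (row r)
      ≡⟨ rowSum (punchIn i r) ⟩
    0ℤ ∎

-- Hence adjacent cofactors in a row are equal: both the minors and the signs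
-- are opposite.
cofactor-adjacent : ∀ {n} (M : Matrix (suc (suc n))) → (∀ r → sumFin (M r) ≡ 0ℤ) →
  (i : Fin (suc (suc n))) (j : Fin (suc n)) → cofactor M i (inject₁ j) ≡ cofactor M i (suc j)
cofactor-adjacent M rowSum i j = begin
  sign (toℕ i +ℕ toℕ (inject₁ j)) * det N
    ≡⟨ cong (λ t → sign (toℕ i +ℕ t) * det N) (toℕ-inject₁ j) ⟩
  sign (toℕ i +ℕ toℕ j) * det N
    ≡⟨ negate-both (sign (toℕ i +ℕ toℕ j)) (det N) ⟩
  (- sign (toℕ i +ℕ toℕ j)) * (- det N)
    ≡⟨ cong₂ _*_ (sym signs-opposite)
                 (sym (inverseʳ-unique (det N) (det N′) (minors-adjacent-opposite M rowSum i j))) ⟩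
  sign (toℕ i +ℕ suc (toℕ j)) * det N′ ∎
  where
  N  = minor i (inject₁ j) M
  N′ = minor i (suc j) M
  negate-both : ∀ s d → s * d ≡ (- s) * (- d)
  negate-both = solve-∀
  signs-opposite : sign (toℕ i +ℕ suc (toℕ j)) ≡ - sign (toℕ i +ℕ toℕ j)
  signs-opposite = trans (cong sign (ℕ.+-suc (toℕ i) (toℕ j))) (sign-suc (toℕ i +ℕ toℕ j))

cofactor-rowConstant : ∀ {n} (M : Matrix (suc (suc n))) → (∀ r → sumFin (M r) ≡ 0ℤ) →
  (i : Fin (suc (suc n))) → ∀ m (j : Fin (suc (suc n))) → toℕ j ≡ m → cofactor M i j ≡ cofactor M i zero
cofactor-rowConstant M rowSum i zero    zero    j≡m = refl
cofactor-rowConstant M rowSum i (suc m) (suc j) j≡m =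
  trans (sym (cofactor-adjacent M rowSum i j))
        (cofactor-rowConstant M rowSum i m (inject₁ j) (trans (toℕ-inject₁ j) (ℕ.suc-injective j≡m)))

-- The cofactors of a symmetric matrix form a symmetric matrix, as minor j i M
-- is the transpose of minor i j M.
cofactor-symmetric : ∀ {n} (M : Matrix (suc n)) → (∀ r c → M r c ≡ M c r) →
  ∀ i j → cofactor M i j ≡ cofactor M j i
cofactor-symmetric M symmetric i j =
  cong₂ _*_ (cong sign (ℕ.+-comm (toℕ i) (toℕ j)))
            (trans (sym (det-transpose (minor i j M)))
                   (det-cong (λ r c → symmetric (punchIn i c) (punchIn j r))))

-- A symmetric matrix whose rows sum to zero has all cofactors equal: each row
-- of cofactors is constant, and by symmetry so is the first column.
cofactors-equal : ∀ {n} (M : Matrix (suc (suc n))) → (∀ r c → M r c ≡ M c r) →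
  (∀ r → sumFin (M r) ≡ 0ℤ) → ∀ i j k l → cofactor M i j ≡ cofactor M k l
cofactors-equal M symmetric rowSum i j k l = trans (to-corner i j) (sym (to-corner k l))
  where
  to-corner : ∀ i j → cofactor M i j ≡ cofactor M zero zero
  to-corner i j = begin
    cofactor M i j       ≡⟨ cofactor-rowConstant M rowSum i (toℕ j) j refl ⟩
    cofactor M i zero    ≡⟨ cofactor-symmetric M symmetric i zero ⟩
    cofactor M zero i    ≡⟨ cofactor-rowConstant M rowSum zero (toℕ i) i refl ⟩
    cofactor M zero zero ∎

multiple<⇒zero : ∀ {p a} → a < suc p → suc p ∣ a → a ≡ 0
multiple<⇒zero {a = zero}  a<p p∣a = refl
multiple<⇒zero {a = suc a} a<p p∣a = ⊥-elim (>⇒∤ a<p p∣a)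

%-invariant⇒∣ : ∀ p A m → (A +ℕ m) % suc p ≡ A % suc p → suc p ∣ m
%-invariant⇒∣ p A m same = divides (k₁ ∸ k₂) (begin
  m
    ≡⟨ sym (ℕ.m+n∸m≡n A m) ⟩
  (A +ℕ m) ∸ A
    ≡⟨ cong₂ _∸_ (m≡m%n+[m/n]*n (A +ℕ m) (suc p)) (m≡m%n+[m/n]*n A (suc p)) ⟩
  ((A +ℕ m) % suc p +ℕ k₁ *ℕ suc p) ∸ (A % suc p +ℕ k₂ *ℕ suc p)
    ≡⟨ cong (λ z → (z +ℕ k₁ *ℕ suc p) ∸ (A % suc p +ℕ k₂ *ℕ suc p)) same ⟩
  (A % suc p +ℕ k₁ *ℕ suc p) ∸ (A % suc p +ℕ k₂ *ℕ suc p)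
    ≡⟨ ℕ.[m+n]∸[m+o]≡n∸o (A % suc p) _ _ ⟩
  k₁ *ℕ suc p ∸ k₂ *ℕ suc p
    ≡⟨ sym (ℕ.*-distribʳ-∸ (suc p) k₁ k₂) ⟩
  (k₁ ∸ k₂) *ℕ suc p ∎)
  where
  k₁ = (A +ℕ m) / suc p
  k₂ = A / suc p

-- Square roots modulo a prime p come in pairs ±x: if a ≤ b < p, b² ≡ a²
-- (mod p) and a + b ≠ 0, then p ∣ (b - a)(a + b), so a = b or a + b = p.
equal-squares-ordered : ∀ q a b → Prime (suc q) → a ≤ b → b < suc q →
  (b *ℕ b) % suc q ≡ (a *ℕ a) % suc q → a +ℕ b ≢ 0 → (a ≡ b) ⊎ (a +ℕ b ≡ suc q)
equal-squares-ordered q a b p-prime a≤b b<p same a+b≢0 with euclidsLemma (b ∸ a) (a +ℕ b) p-prime p∣product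
  where
  d = b ∸ a
  b≡d+a : b ≡ d +ℕ a
  b≡d+a = sym (ℕ.m∸n+n≡m a≤b)
  expand : ∀ d a → (d +ℕ a) *ℕ (d +ℕ a) ≡ a *ℕ a +ℕ d *ℕ (a +ℕ (d +ℕ a))
  expand = solveℕ
  b²≡a²+d[a+b] : b *ℕ b ≡ a *ℕ a +ℕ d *ℕ (a +ℕ b)
  b²≡a²+d[a+b] = trans (cong (λ z → z *ℕ z) b≡d+a)
                       (trans (expand d a) (cong (λ z → a *ℕ a +ℕ d *ℕ (a +ℕ z)) (sym b≡d+a)))
  p∣product : suc q ∣ d *ℕ (a +ℕ b)
  p∣product = %-invariant⇒∣ q (a *ℕ a) (d *ℕ (a +ℕ b)) (trans (cong (_% suc q) (sym b²≡a²+d[a+b])) same)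
... | inj₁ p∣b-a = inj₁ (trans (cong (_+ℕ a) (sym b-a≡0)) (ℕ.m∸n+n≡m a≤b))
  where
  b-a≡0 : b ∸ a ≡ 0
  b-a≡0 = multiple<⇒zero (ℕ.≤-<-trans (ℕ.m∸n≤m b a) b<p) p∣b-a
... | inj₂ (divides zero          a+b≡0)  = ⊥-elim (a+b≢0 a+b≡0)
... | inj₂ (divides (suc zero)    a+b≡p)  = inj₂ (trans a+b≡p (ℕ.+-identityʳ (suc q)))
... | inj₂ (divides (suc (suc k)) a+b≡kp) = ⊥-elim (ℕ.<⇒≱ a+b<2p 2p≤a+b)
  where
  a+b<2p : a +ℕ b < suc q +ℕ suc q
  a+b<2p = ℕ.≤-<-trans (ℕ.+-monoˡ-≤ b a≤b) (ℕ.+-mono-< b<p b<p)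
  2p≤a+b : suc q +ℕ suc q ≤ a +ℕ b
  2p≤a+b = subst (suc q +ℕ suc q ≤_) (trans (ℕ.+-assoc (suc q) (suc q) (k *ℕ suc q)) (sym a+b≡kp))
                 (ℕ.m≤m+n (suc q +ℕ suc q) (k *ℕ suc q))

equal-squares : ∀ q → Prime (suc q) → (x y : ℕ) → x < suc q → y < suc q → y ≢ 0 →
  (x *ℕ x) % suc q ≡ (y *ℕ y) % suc q → (x ≡ y) ⊎ (x +ℕ y ≡ suc q)
equal-squares q p-prime x y x<p y<p y≢0 same with ℕ.≤-total x y
... | inj₁ x≤y = equal-squares-ordered q x y p-prime x≤y y<p (sym same) (y≢0 ∘ ℕ.m+n≡0⇒n≡0 x)
... | inj₂ y≤x with equal-squares-ordered q y x p-prime y≤x x<p same (y≢0 ∘ ℕ.m+n≡0⇒m≡0 y)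
...   | inj₁ y≡x   = inj₁ (sym y≡x)
...   | inj₂ y+x≡p = inj₂ (trans (ℕ.+-comm x y) y+x≡p)

square-complement : ∀ q y → y ≤ suc q → ((suc q ∸ y) *ℕ (suc q ∸ y)) % suc q ≡ (y *ℕ y) % suc q
square-complement q y y≤p = begin
  (z *ℕ z) % suc q                       ≡⟨ sym ([m+kn]%n≡m%n (z *ℕ z) y (suc q)) ⟩
  (z *ℕ z +ℕ y *ℕ suc q) % suc q          ≡⟨ cong (λ w → (z *ℕ z +ℕ y *ℕ w) % suc q) (sym z+y≡p) ⟩
  (z *ℕ z +ℕ y *ℕ (z +ℕ y)) % suc q       ≡⟨ cong (_% suc q) (swap z y) ⟩
  (y *ℕ y +ℕ z *ℕ (z +ℕ y)) % suc q       ≡⟨ cong (λ w → (y *ℕ y +ℕ z *ℕ w) % suc q) z+y≡p ⟩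
  (y *ℕ y +ℕ z *ℕ suc q) % suc q          ≡⟨ [m+kn]%n≡m%n (y *ℕ y) z (suc q) ⟩
  (y *ℕ y) % suc q                       ∎
  where
  z = suc q ∸ y
  z+y≡p : z +ℕ y ≡ suc q
  z+y≡p = ℕ.m∸n+n≡m y≤p
  swap : ∀ z y → z *ℕ z +ℕ y *ℕ (z +ℕ y) ≡ y *ℕ y +ℕ z *ℕ (z +ℕ y)
  swap = solveℕ

odd-prime≢double : ∀ q → Prime (suc q) → suc q ≢ 2 → ∀ y → y +ℕ y ≢ suc q
odd-prime≢double q p-prime p≢2 y y+y≡p with prime⇒irreducible p-prime (divides y (trans (sym y+y≡p) (double y)))
  where
  double : ∀ y → y +ℕ y ≡ y *ℕ 2
  double = solveℕ
... | inj₁ ()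
... | inj₂ 2≡p = p≢2 (sym 2≡p)

square≡0⇒zero : ∀ q → Prime (suc q) → (x : Fin (suc q)) → (toℕ x *ℕ toℕ x) % suc q ≡ 0 → x ≡ zero
square≡0⇒zero q p-prime x x²≡0 with euclidsLemma (toℕ x) (toℕ x) p-prime (m%n≡0⇒n∣m _ (suc q) x²≡0)
... | inj₁ p∣x = toℕ-injective (multiple<⇒zero (toℕ<n x) p∣x)
... | inj₂ p∣x = toℕ-injective (multiple<⇒zero (toℕ<n x) p∣x)

legendre-mod : ∀ q a b → a % suc q ≡ b % suc q → legendre (suc q) a ≡ legendre (suc q) b
legendre-mod q a b a≡b with suc q ∣? a | suc q ∣? b
... | yes _   | yes _   = refl
... | yes p∣a | no p∤b  = ⊥-elim (p∤b (m%n≡0⇒n∣m b (suc q) (trans (sym a≡b) (n∣m⇒m%n≡0 a (suc q) p∣a))))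
... | no p∤a  | yes p∣b = ⊥-elim (p∤a (m%n≡0⇒n∣m a (suc q) (trans a≡b (n∣m⇒m%n≡0 b (suc q) p∣b))))
... | no _    | no _
  with any? (λ (x : Fin (suc q)) → (toℕ x *ℕ toℕ x) % suc q ≟ a % suc q)
     | any? (λ (x : Fin (suc q)) → (toℕ x *ℕ toℕ x) % suc q ≟ b % suc q)
...   | yes _        | yes _        = refl
...   | yes (x , x²) | no none      = ⊥-elim (none (x , trans x² a≡b))
...   | no none      | yes (x , x²) = ⊥-elim (none (x , trans x² (sym a≡b)))
...   | no _         | no _         = refl

𝟙 : ∀ {P : Set} → Dec P → ℤ
𝟙 (yes _) = 1ℤ
𝟙 (no _)  = 0ℤ

𝟙-yes : ∀ {P : Set} (d : Dec P) → P → 𝟙 d ≡ 1ℤ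
𝟙-yes (yes _) _ = refl
𝟙-yes (no ¬p) p = ⊥-elim (¬p p)

𝟙-no : ∀ {P : Set} (d : Dec P) → ¬ P → 𝟙 d ≡ 0ℤ
𝟙-no (yes p) ¬p = ⊥-elim (¬p p)
𝟙-no (no _)  _  = refl

isRoot : ∀ q → Fin (suc q) → Fin (suc q) → ℤ
isRoot q a x = 𝟙 ((toℕ x *ℕ toℕ x) % suc q ≟ toℕ a)

rootCount : ∀ q → Fin (suc q) → ℤ
rootCount q a = sumFin (isRoot q a)

-- Modulo an odd prime, a residue a with a nonzero square root y has exactly
-- the two roots y and p - y, which are distinct because p is odd.
rootCount-residue : ∀ q → Prime (suc q) → suc q ≢ 2 → (a y : Fin (suc q)) → toℕ y ≢ 0 →
  (toℕ y *ℕ toℕ y) % suc q ≡ toℕ a → rootCount q a ≡ + 2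
rootCount-residue q p-prime p≢2 a y y≢0 y²≡a =
  trans (sumFin-pair (isRoot q a) y y′ y≢y′ other-roots-vanish)
        (cong₂ _+_ (𝟙-yes ((toℕ y *ℕ toℕ y) % suc q ≟ toℕ a) y²≡a)
                   (𝟙-yes ((toℕ y′ *ℕ toℕ y′) % suc q ≟ toℕ a) y′²≡a))
  where
  p-y<p : suc q ∸ toℕ y < suc q
  p-y<p = ℕ.∸-monoʳ-< {o = 0} (ℕ.n≢0⇒n>0 y≢0) (ℕ.<⇒≤ (toℕ<n y))
  y′ : Fin (suc q)
  y′ = fromℕ< p-y<p
  toℕ-y′ : toℕ y′ ≡ suc q ∸ toℕ y
  toℕ-y′ = toℕ-fromℕ< p-y<p
  y′²≡a : (toℕ y′ *ℕ toℕ y′) % suc q ≡ toℕ a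
  y′²≡a = trans (cong (λ w → (w *ℕ w) % suc q) toℕ-y′)
                (trans (square-complement q (toℕ y) (ℕ.<⇒≤ (toℕ<n y))) y²≡a)
  y′+y≡p : toℕ y′ +ℕ toℕ y ≡ suc q
  y′+y≡p = trans (cong (_+ℕ toℕ y) toℕ-y′) (ℕ.m∸n+n≡m (ℕ.<⇒≤ (toℕ<n y)))
  y≢y′ : y ≢ y′
  y≢y′ y≡y′ = odd-prime≢double q p-prime p≢2 (toℕ y)
                (trans (cong (λ w → toℕ w +ℕ toℕ y) y≡y′) y′+y≡p)
  other-roots-vanish : ∀ x → x ≢ y → x ≢ y′ → isRoot q a x ≡ 0ℤ
  other-roots-vanish x x≢y x≢y′ = 𝟙-no _ λ x²≡a →
    [ (λ x≡y → x≢y (toℕ-injective x≡y))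
    , (λ x+y≡p → x≢y′ (toℕ-injective
                          (ℕ.+-cancelʳ-≡ (toℕ y) (toℕ x) (toℕ y′) (trans x+y≡p (sym y′+y≡p)))))
    ]′ (equal-squares q p-prime (toℕ x) (toℕ y) (toℕ<n x) (toℕ<n y) y≢0 (trans x²≡a (sym y²≡a)))

-- For an odd prime p, (a/p) + 1 is the number of square roots of a: the only
-- root of 0 is 0, a nonresidue has none, and a nonzero residue has two.
legendre-counts-roots : ∀ q → Prime (suc q) → suc q ≢ 2 → (a : Fin (suc q)) →
  legendre (suc q) (toℕ a) + 1ℤ ≡ rootCount q a
legendre-counts-roots q p-prime p≢2 a with suc q ∣? toℕ a
... | yes p∣a = begin
  0ℤ + 1ℤ         ≡⟨ sym (𝟙-yes (0 ≟ toℕ a) (sym a≡0)) ⟩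
  isRoot q a zero ≡⟨ sym (sumFin-single (isRoot q a) zero only-root-0) ⟩
  rootCount q a   ∎
  where
  a≡0 : toℕ a ≡ 0
  a≡0 = multiple<⇒zero (toℕ<n a) p∣a
  only-root-0 : ∀ x → x ≢ zero → isRoot q a x ≡ 0ℤ
  only-root-0 x x≢0 = 𝟙-no _ (λ x²≡a → x≢0 (square≡0⇒zero q p-prime x (trans x²≡a a≡0)))
... | no p∤a with any? (λ (x : Fin (suc q)) → (toℕ x *ℕ toℕ x) % suc q ≟ toℕ a % suc q)
...   | no no-root = sym (sumFin-zero (isRoot q a)
                       (λ x → 𝟙-no _ (λ x²≡a → no-root (x , trans x²≡a (sym a%p≡a)))))
  where
  a%p≡a : toℕ a % suc q ≡ toℕ a
  a%p≡a = m<n⇒m%n≡m (toℕ<n a)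
...   | yes (y , y²≡a%p) = sym (rootCount-residue q p-prime p≢2 a y y≢0 (trans y²≡a%p a%p≡a))
  where
  a%p≡a : toℕ a % suc q ≡ toℕ a
  a%p≡a = m<n⇒m%n≡m (toℕ<n a)
  y≢0 : toℕ y ≢ 0
  y≢0 y≡0 = p∤a (m%n≡0⇒n∣m (toℕ a) (suc q) (trans (sym y²≡a%p) (cong (λ w → (w *ℕ w) % suc q) y≡0)))

-- Counting pairs (a, x) with x² ≡ a gives Σ_a ((a/p) + 1) = Σ_a #roots(a) = p,
-- since every x is a square root of exactly one residue a.
legendre-sum : ∀ q → Prime (suc q) → suc q ≢ 2 →
  sumFin (λ (a : Fin (suc q)) → legendre (suc q) (toℕ a)) ≡ 0ℤ
legendre-sum q p-prime p≢2 = ∙-cancelʳ (+ suc q) (sumFin χ) 0ℤ (begin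
  sumFin χ + + suc q                         ≡⟨ cong (_+_ (sumFin χ)) (sym (sumFin-one (suc q))) ⟩
  sumFin χ + sumFin {suc q} (λ _ → 1ℤ)       ≡⟨ sym (sumFin-+ χ (λ _ → 1ℤ)) ⟩
  sumFin (λ a → χ a + 1ℤ)                    ≡⟨ sumFin-cong (legendre-counts-roots q p-prime p≢2) ⟩
  sumFin (rootCount q)                       ≡⟨ sumFin-swap (isRoot q) ⟩
  sumFin (λ x → sumFin (λ a → isRoot q a x)) ≡⟨ sumFin-cong root-of-one-residue ⟩
  sumFin {suc q} (λ _ → 1ℤ)                  ≡⟨ sumFin-one (suc q) ⟩
  + suc q                                    ∎)
  where
  χ : Fin (suc q) → ℤ
  χ a = legendre (suc q) (toℕ a)
  root-of-one-residue : ∀ x → sumFin (λ a → isRoot q a x) ≡ 1ℤ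
  root-of-one-residue x = trans (sumFin-single (λ a → isRoot q a x) x² other-residues)
                                (𝟙-yes ((toℕ x *ℕ toℕ x) % suc q ≟ toℕ x²) (sym toℕ-x²))
    where
    x²<p = m%n<n (toℕ x *ℕ toℕ x) (suc q)
    x² : Fin (suc q)
    x² = fromℕ< x²<p
    toℕ-x² : toℕ x² ≡ (toℕ x *ℕ toℕ x) % suc q
    toℕ-x² = toℕ-fromℕ< x²<p
    other-residues : ∀ a → a ≢ x² → isRoot q a x ≡ 0ℤ
    other-residues a a≢x² = 𝟙-no _ (λ x²≡a → a≢x² (toℕ-injective (trans (sym x²≡a) (sym toℕ-x²))))

sumℕ : ℕ → (ℕ → ℤ) → ℤ
sumℕ zero    h = 0ℤ
sumℕ (suc n) h = h 0 + sumℕ n (h ∘ suc)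

sumFin-toℕ : ∀ n (h : ℕ → ℤ) → sumFin {n} (h ∘ toℕ) ≡ sumℕ n h
sumFin-toℕ zero    h = refl
sumFin-toℕ (suc n) h = cong (_+_ (h 0)) (sumFin-toℕ n (h ∘ suc))

sumℕ-cong : ∀ n {g h : ℕ → ℤ} → (∀ c → g c ≡ h c) → sumℕ n g ≡ sumℕ n h
sumℕ-cong zero    e = refl
sumℕ-cong (suc n) e = cong₂ _+_ (e 0) (sumℕ-cong n (e ∘ suc))

sumℕ-rotate : ∀ n (h : ℕ → ℤ) → sumℕ n (h ∘ suc) + h 0 ≡ sumℕ n h + h n
sumℕ-rotate zero    h = refl
sumℕ-rotate (suc n) h = begin
  (h 1 + sumℕ n (λ c → h (suc (suc c)))) + h 0 ≡⟨ swap-first (h 1) _ (h 0) ⟩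
  (sumℕ n (λ c → h (suc (suc c))) + h 1) + h 0 ≡⟨ cong (_+ h 0) (sumℕ-rotate n (λ c → h (suc c))) ⟩
  (sumℕ n (λ c → h (suc c)) + h (suc n)) + h 0 ≡⟨ move-last _ (h (suc n)) (h 0) ⟩
  (h 0 + sumℕ n (λ c → h (suc c))) + h (suc n) ∎
  where
  swap-first : ∀ a b c → (a + b) + c ≡ (b + a) + c
  swap-first = solve-∀
  move-last : ∀ a b c → (a + b) + c ≡ (c + a) + b
  move-last = solve-∀

sumℕ-periodic : ∀ n (h : ℕ → ℤ) → (∀ m → h (m +ℕ n) ≡ h m) →
  ∀ s → sumℕ n (λ c → h (s +ℕ c)) ≡ sumℕ n h
sumℕ-periodic n h periodic zero    = refl
sumℕ-periodic n h periodic (suc s) = begin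
  sumℕ n (λ c → h (suc s +ℕ c))
    ≡⟨ sumℕ-cong n (λ c → cong h (sym (ℕ.+-suc s c))) ⟩
  sumℕ n (g ∘ suc)
    ≡⟨ ∙-cancelʳ (g 0) _ _ (trans (sumℕ-rotate n g) (cong (_+_ (sumℕ n g)) ends-agree)) ⟩
  sumℕ n g
    ≡⟨ sumℕ-periodic n h periodic s ⟩
  sumℕ n h ∎
  where
  g : ℕ → ℤ
  g c = h (s +ℕ c)
  ends-agree : g n ≡ g 0
  ends-agree = trans (periodic s) (cong h (sym (ℕ.+-identityʳ s)))

A-symmetric : ∀ p (r c : Fin p) → A p r c ≡ A p c r
A-symmetric p r c = cong (λ z → legendre p (z +ℕ 1)) (ℕ.+-comm (toℕ r) (toℕ c))

-- Each row of A p is a window of length p of the p-periodic Legendre symbol,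
-- so it sums to Σ_a (a/p) = 0.
A-rowSum : ∀ q → Prime (suc q) → suc q ≢ 2 → (r : Fin (suc q)) → sumFin (A (suc q) r) ≡ 0ℤ
A-rowSum q p-prime p≢2 r = begin
  sumFin {suc q} (λ c → χ (toℕ r +ℕ toℕ c +ℕ 1))
    ≡⟨ sumFin-cong {suc q} (λ c → cong χ (ℕ.+-comm (toℕ r +ℕ toℕ c) 1)) ⟩
  sumFin {suc q} (λ c → χ (suc (toℕ r) +ℕ toℕ c))
    ≡⟨ sumFin-toℕ (suc q) (λ c → χ (suc (toℕ r) +ℕ c)) ⟩
  sumℕ (suc q) (λ c → χ (suc (toℕ r) +ℕ c))
    ≡⟨ sumℕ-periodic (suc q) χ χ-periodic (suc (toℕ r)) ⟩
  sumℕ (suc q) χ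
    ≡⟨ sym (sumFin-toℕ (suc q) χ) ⟩
  sumFin {suc q} (χ ∘ toℕ)
    ≡⟨ legendre-sum q p-prime p≢2 ⟩
  0ℤ ∎
  where
  χ : ℕ → ℤ
  χ = legendre (suc q)
  χ-periodic : ∀ m → χ (m +ℕ suc q) ≡ χ m
  χ-periodic m = legendre-mod q (m +ℕ suc q) m ([m+n]%n≡m%n m (suc q))

lemma3 : (q : ℕ) → Prime (suc q) → suc q ≢ 2 →
    (i j k l : Fin (suc q)) → cofactor (A (suc q)) i j ≡ cofactor (A (suc q)) k l
lemma3 zero    p-prime p≢2 = ⊥-elim (¬prime[1] p-prime)
lemma3 (suc q) p-prime p≢2 =
  cofactors-equal (A (suc (suc q))) (A-symmetric (suc (suc q))) (A-rowSum (suc q) p-prime p≢2)
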